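{- Any two signatures of the Petersen graph that are not switching isomorphic have different chromatic polynomials; in particular, they have different numbers $\chi_{(P,\sigma)}(3)$ of proper $1$-colorations.
   Context: The Petersen graph $P$ has vertices $v_{ij}$ for the 2-element subsets $\{i,j\}\subseteq\{1,\dots,5\}$, with $v_{ij}v_{kl}$ an edge iff $\{i,j\}\cap\{k,l\}=\emptyset$; a signature is $\sigma:E(P)\to\{+,-\}$. A proper $k$-coloration of $(P,\sigma)$ is $\kappa:V\to\{0,\pm1,\dots,\pm k\}$ with $\kappa(w)\neq\sigma(vw)\kappa(v)$ for every edge $vw$. The chromatic polynomial is the polynomial $\chi_{(P,\sigma)}$ with $\chi_{(P,\sigma)}(2k+1)=$ the number of proper $k$-colorations for all $k\ge0$. Switching by $\zeta:V\to\{+,-\}$ gives $\sigma^\zeta(vw)=\zeta(v)\sigma(vw)\zeta(w)$; two signatures are switching isomorphic if one is isomorphic (via a sign-preserving graph automorphism) to a switching of the other. -}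

module Defs where

open import Data.Bool using (Bool; true; false; T; not; _∧_; _∨_; if_then_else_)
open import Data.Unit using (tt)
open import Data.Nat as ℕ using (ℕ; zero; suc; _<ᵇ_)
open import Data.Fin as Fin using (Fin; toℕ)
open import Data.Fin.Patterns
open import Data.Integer as ℤ using (ℤ; +_; -_; _-_)
open import Data.Sign as Sign using (Sign) renaming (+ to ⊕; - to ⊖)
open import Data.Product using (Σ; _×_; _,_; proj₁; proj₂; ∃)
open import Data.List as List using (List; []; _∷_; [_]; map; concatMap; filter; length; upTo; allFin)
open import Data.Bool.ListAction using (and)
open import Data.Vec as Vec using (Vec; lookup)
open import Relation.Nullary using (does)
open import Relation.Binary.PropositionalEquality using (_≡_; _≢_; sym; subst)
open import Function using (_∘_)

-- The Petersen graph P.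
-- Vertices are indexed by Fin 10; vertex u stands for the 2-subset
-- label u = {i , j} of {1,...,5} (encoded as Fin 5, so 0 ↦ 1, ..., 4 ↦ 5),
-- listed in lexicographic order.

V : Set
V = Fin 10

label : V → Fin 5 × Fin 5
label 0F = 0F , 1F
label 1F = 0F , 2F
label 2F = 0F , 3F
label 3F = 0F , 4F
label 4F = 1F , 2F
label 5F = 1F , 3F
label 6F = 1F , 4F
label 7F = 2F , 3F
label 8F = 2F , 4F
label 9F = 3F , 4F

_=ᶠ_ : Fin 5 → Fin 5 → Bool
a =ᶠ b = does (a Fin.≟ b)

adj : V → V → Bool
adj u v with label u | label v
... | a , b | c , d = not ((a =ᶠ c) ∨ (a =ᶠ d) ∨ (b =ᶠ c) ∨ (b =ᶠ d))

Edge : Set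
Edge = Σ (V × V) λ p → T (adj (proj₁ p) (proj₂ p)) × T (toℕ (proj₁ p) <ᵇ toℕ (proj₂ p))

Signature : Set
Signature = Edge → Sign

sig : Signature → (u v : V) → T (adj u v) → Sign
sig σ u v a with toℕ u <ᵇ toℕ v in e1
... | true = σ ((u , v) , a , subst T (sym e1) tt)
... | false with toℕ v <ᵇ toℕ u in e2 | adj v u in e3
...   | true  | true = σ ((v , u) , subst T (sym e3) tt , subst T (sym e2) tt)
...   | _     | _    = ⊕   -- unreachable: adjacent vertices are distinct and adj is symmetric

record Automorphism : Set where
  field
    π      : V → V
    π⁻¹    : V → V
    inv₁   : ∀ v → π⁻¹ (π v) ≡ v
    inv₂   : ∀ v → π (π⁻¹ v) ≡ v
    preserves : ∀ u v → adj u v ≡ adj (π u) (π v)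

SwitchingIsomorphic : Signature → Signature → Set
SwitchingIsomorphic σ τ =
  Σ Automorphism λ φ → Σ (V → Sign) λ ζ →
    ∀ u v (a : T (adj u v)) →
      sig τ (Automorphism.π φ u) (Automorphism.π φ v)
            (subst T (Automorphism.preserves φ u v) a)
        ≡ ζ u Sign.* (sig σ u v a Sign.* ζ v)

act : Sign → ℤ → ℤ
act ⊕ x = x
act ⊖ x = - x

colours : ℕ → List ℤ
colours k = map (λ i → (+ i) - (+ k)) (upTo (suc (2 ℕ.* k)))

allVecs : (n : ℕ) → List ℤ → List (Vec ℤ n)
allVecs zero    cs = [ Vec.[] ]
allVecs (suc n) cs = concatMap (λ c → map (c Vec.∷_) (allVecs n cs)) cs

_≠ᶻ_ : ℤ → ℤ → Bool
x ≠ᶻ y = not (does (x ℤ.≟ y))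

okAt : Signature → Vec ℤ 10 → V → V → Bool
okAt σ κ u v with adj u v in e
... | true  = lookup κ v ≠ᶻ act (sig σ u v (subst T (sym e) tt)) (lookup κ u)
... | false = true

isProper : Signature → Vec ℤ 10 → Bool
isProper σ κ = and (concatMap (λ u → map (okAt σ κ u) (allFin 10)) (allFin 10))

-- number of proper k-colorations κ : V → {0, ±1, ..., ±k} of (P, σ);
-- this is χ_(P,σ)(2k+1).
numColorations : Signature → ℕ → ℕ
numColorations σ k = length (filter (λ κ → T? (isProper σ κ)) (allVecs 10 (colours k)))
  where open import Data.Bool.Properties using (T?)

-- Chromatic polynomial: integer polynomials as coefficient lists
-- (constant term first); p is the chromatic polynomial of (P,σ) iff
-- p(2k+1) = number of proper k-colorations for all k ≥ 0.

eval : List ℤ → ℤ → ℤ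
eval []       x = + 0
eval (c ∷ cs) x = c ℤ.+ x ℤ.* eval cs x

IsChromaticPolynomial : Signature → List ℤ → Set
IsChromaticPolynomial σ p = ∀ k → eval p (+ suc (2 ℕ.* k)) ≡ + numColorations σ k

-- A switching isomorphism (π, ζ) from σ to τ carries a proper colouring κ of σ to the proper
-- colouring x ↦ ζ(π⁻¹ x) κ(π⁻¹ x) of τ, bijectively; so the number of proper k-colourings is a
-- switching invariant. Switching along a spanning tree makes its nine edges positive, hence
-- every signature is switching isomorphic to one of 2⁶ normal forms fixed by the six cotree
-- edges. These fall into six classes whose representatives have 120, 112, 136, 108, 80 and 202
-- proper 1-colourings, so the number of 1-colourings, i.e. χ(3), determines the class.

module Submission where

open import Defs
open import Data.Integer using (ℤ)
open import Data.List using (List)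
open import Data.Product using (Σ; _×_)
open import Relation.Nullary using (¬_)
open import Relation.Binary.PropositionalEquality using (_≡_; _≢_)

open import Data.Bool as Bool using (Bool; true; false; T; not; if_then_else_)
open import Data.Bool.ListAction using (and; any)
open import Data.Bool.Properties using (T?; T-∧; T-irrelevant)
open import Data.Fin as Fin using (Fin)
open import Data.Fin.Patterns
open import Data.Fin.Properties using (all?)
open import Data.Integer using (+_; -_; _+_; _-_)
open import Data.Integer.Properties using (+-injective; pos-+; neg-involutive)
open import Data.Integer.Tactic.RingSolver using (solve-∀)
import Data.Integer as ℤ
open import Data.List using ([]; _∷_; _++_; map; filter; length; concatMap; cartesianProductWith; allFin; foldr)
open import Data.List.Membership.Propositional using (_∈_)
open import Data.List.Membership.Propositional.Properties
  using (∈-map⁺; ∈-map⁻; ∈-upTo⁺; ∈-upTo⁻; ∈-cartesianProductWith⁺; ∈-cartesianProductWith⁻)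
open import Data.List.Membership.Propositional.Properties.WithK using (unique∧set⇒bag)
open import Data.List.Properties using (filter-≐)
open import Data.List.Relation.Binary.BagAndSetEquality using (∼bag⇒↭)
open import Data.List.Relation.Binary.Permutation.Propositional using (_↭_)
open import Data.List.Relation.Binary.Permutation.Propositional.Properties using (↭-length; filter-↭)
open import Data.List.Relation.Unary.All using (All; []; _∷_)
open import Data.List.Relation.Unary.All.Properties using (concat⁺; concat⁻; map⁺; map⁻; tabulate⁺; tabulate⁻)
open import Data.List.Relation.Unary.AllPairs using ([]; _∷_)
open import Data.List.Relation.Unary.Any using (here)
open import Data.List.Relation.Unary.Unique.Propositional using (Unique)
import Data.List.Relation.Unary.Unique.Propositional.Properties as Unique
open import Data.Nat as ℕ using (ℕ; zero; suc; _∸_)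
open import Data.Nat.Properties using (m+[n∸m]≡n; m∸n≤m; +-identityʳ)
open import Data.Product using (_,_; proj₁; proj₂; map₂)
open import Data.Sign as Sign using (Sign; _*_) renaming (+ to ⊕; - to ⊖)
open import Data.Sign.Properties using (*-commutativeMonoid; s*s≡+; *-identityʳ)
open import Data.Sum using (_⊎_; inj₁; inj₂)
open import Data.Unit using (⊤; tt)
open import Data.Vec as Vec using (Vec; lookup; tabulate; []; _∷_)
open import Data.Vec.Properties using (∷-injective; lookup∘tabulate; tabulate-cong; tabulate∘lookup)
open import Data.Vec.Relation.Unary.All as VecAll using ([]; _∷_)
open import Data.Vec.Relation.Unary.All.Properties using (lookup⁺; lookup⁻)
open import Function using (_∘_; id; _⇔_; mk⇔; Equivalence)
open import Relation.Binary.PropositionalEquality using (refl; sym; trans; cong; cong₂; subst; subst₂; module ≡-Reasoning)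
open import Relation.Nullary using (Dec; yes; does)
open import Relation.Nullary.Decidable using (True; toWitness; does-⇔; map′; _×-dec_; _→-dec_)
open import Algebra.Solver.CommutativeMonoid *-commutativeMonoid using (solve; _⊜_) renaming (_⊕_ to _·_)

private
  variable
    A B C : Set
    n : ℕ

count : (A → Bool) → List A → ℕ
count P xs = length (filter (T? ∘ P) xs)

count-map : ∀ (P : B → Bool) (f : A → B) xs → count P (map f xs) ≡ count (P ∘ f) xs
count-map P f []       = refl
count-map P f (x ∷ xs) with P (f x)
... | true  = cong suc (count-map P f xs)
... | false = count-map P f xs

count-cong : ∀ {P Q : A → Bool} → (∀ x → P x ≡ Q x) → ∀ xs → count P xs ≡ count Q xs
count-cong P≗Q xs = cong length
  (filter-≐ (T? ∘ _) (T? ∘ _) ((λ {x} → subst T (P≗Q x)) , (λ {x} → subst T (sym (P≗Q x)))) xs)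

count-↭ : ∀ (P : A → Bool) {xs ys} → xs ↭ ys → count P xs ≡ count P ys
count-↭ P xs↭ys = ↭-length (filter-↭ (T? ∘ P) xs↭ys)

concatMap-map≡cartesianProductWith : ∀ (f : A → B → C) xs ys →
  concatMap (λ x → map (f x) ys) xs ≡ cartesianProductWith f xs ys
concatMap-map≡cartesianProductWith f []       ys = refl
concatMap-map≡cartesianProductWith f (x ∷ xs) ys =
  cong (map (f x) ys ++_) (concatMap-map≡cartesianProductWith f xs ys)

allVecs-suc : ∀ n (cs : List ℤ) → allVecs (suc n) cs ≡ cartesianProductWith Vec._∷_ cs (allVecs n cs)
allVecs-suc n cs = concatMap-map≡cartesianProductWith Vec._∷_ cs (allVecs n cs)

Over : List ℤ → Vec ℤ n → Set
Over cs = VecAll.All (_∈ cs)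

∈-allVecs⁺ : ∀ {cs} {κ : Vec ℤ n} → Over cs κ → κ ∈ allVecs n cs
∈-allVecs⁺ []                        = here refl
∈-allVecs⁺ {n = suc n} {cs} (c∈ ∷ κ∈) =
  subst (_ ∈_) (sym (allVecs-suc n cs)) (∈-cartesianProductWith⁺ Vec._∷_ c∈ (∈-allVecs⁺ κ∈))

∈-allVecs⁻ : ∀ {cs} {κ : Vec ℤ n} → κ ∈ allVecs n cs → Over cs κ
∈-allVecs⁻ {n = zero}  {κ = Vec.[]} _ = []
∈-allVecs⁻ {n = suc n} {cs} κ∈
  with _ , _ , c∈ , κ′∈ , refl ← ∈-cartesianProductWith⁻ Vec._∷_ cs (allVecs n cs)
                                   (subst (_ ∈_) (allVecs-suc n cs) κ∈)
  = c∈ ∷ ∈-allVecs⁻ κ′∈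

allVecs-unique : ∀ n {cs} → Unique cs → Unique (allVecs n cs)
allVecs-unique zero    _      = [] ∷ []
allVecs-unique (suc n) {cs} u = subst Unique (sym (allVecs-suc n cs))
  (Unique.cartesianProductWith⁺ Vec._∷_ ∷-injective u (allVecs-unique n u))

-- Both lists are duplicate-free with the same elements, hence permutations of each other.
module _ {cs} (cs-unique : Unique cs) (f g : Vec ℤ n → Vec ℤ n)
         (f-over : ∀ {κ} → Over cs κ → Over cs (f κ)) (g-over : ∀ {κ} → Over cs κ → Over cs (g κ))
         (f∘g : ∀ κ → f (g κ) ≡ κ) (g∘f : ∀ κ → g (f κ) ≡ κ) where

  map-allVecs-↭ : map f (allVecs n cs) ↭ allVecs n cs
  map-allVecs-↭ = ∼bag⇒↭ (unique∧set⇒bag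
    (Unique.map⁺ f-injective (allVecs-unique n cs-unique)) (allVecs-unique n cs-unique) (mk⇔ to from))
    where
    f-injective : ∀ {κ κ′} → f κ ≡ f κ′ → κ ≡ κ′
    f-injective {κ} {κ′} eq = trans (sym (g∘f κ)) (trans (cong g eq) (g∘f κ′))
    to : ∀ {κ} → κ ∈ map f (allVecs n cs) → κ ∈ allVecs n cs
    to κ∈ with _ , κ′∈ , refl ← ∈-map⁻ f κ∈ = ∈-allVecs⁺ (f-over (∈-allVecs⁻ κ′∈))
    from : ∀ {κ} → κ ∈ allVecs n cs → κ ∈ map f (allVecs n cs)
    from {κ} κ∈ = subst (_∈ _) (f∘g κ) (∈-map⁺ f (∈-allVecs⁺ (g-over (∈-allVecs⁻ κ∈))))

  count-allVecs-∘ : ∀ P → count P (allVecs n cs) ≡ count (P ∘ f) (allVecs n cs)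
  count-allVecs-∘ P = trans (sym (count-↭ P map-allVecs-↭)) (count-map P f (allVecs n cs))

colour-injective : ∀ {k i j} → + i - + k ≡ + j - + k → i ≡ j
colour-injective {k} {i} {j} eq = +-injective (begin
  + i              ≡⟨ undo (+ i) (+ k) ⟨
  + i - + k + + k  ≡⟨ cong (_+ + k) eq ⟩
  + j - + k + + k  ≡⟨ undo (+ j) (+ k) ⟩
  + j              ∎)
  where
  open ≡-Reasoning
  undo : ∀ a c → a - c + c ≡ a
  undo = solve-∀

colours-unique : ∀ k → Unique (colours k)
colours-unique k = Unique.map⁺ (colour-injective {k}) (Unique.upTo⁺ _)

neg-colour : ∀ a b c → a + b ≡ c + c → - (a - c) ≡ b - c
neg-colour a b c a+b≡c+c = begin
  - (a - c)        ≡⟨ reflect a c ⟩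
  (c + c - a) - c  ≡⟨ cong (λ x → x - a - c) a+b≡c+c ⟨
  (a + b - a) - c  ≡⟨ cancel a b c ⟩
  b - c            ∎
  where
  open ≡-Reasoning
  reflect : ∀ a c → - (a - c) ≡ (c + c - a) - c
  reflect = solve-∀
  cancel : ∀ a b c → (a + b - a) - c ≡ b - c
  cancel = solve-∀

-- The colour i - k is sent to (2k - i) - k.
neg-∈-colours : ∀ k {x} → x ∈ colours k → - x ∈ colours k
neg-∈-colours k x∈ with i , i∈ , refl ← ∈-map⁻ _ x∈ =
  subst (_∈ colours k) (sym (neg-colour (+ i) (+ (2k ∸ i)) (+ k) i+[2k∸i]≡k+k))
        (∈-map⁺ (λ i → + i - + k) (∈-upTo⁺ (ℕ.s≤s (m∸n≤m 2k i))))
  where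
  2k : ℕ
  2k = 2 ℕ.* k
  i+[2k∸i]≡k+k : + i + + (2k ∸ i) ≡ + k + + k
  i+[2k∸i]≡k+k = begin
    + i + + (2k ∸ i)    ≡⟨ pos-+ i (2k ∸ i) ⟨
    + (i ℕ.+ (2k ∸ i))  ≡⟨ cong +_ (m+[n∸m]≡n (ℕ.s≤s⁻¹ (∈-upTo⁻ i∈))) ⟩
    + 2k                ≡⟨ cong (λ m → + (k ℕ.+ m)) (+-identityʳ k) ⟩
    + (k ℕ.+ k)         ≡⟨ pos-+ k k ⟩
    + k + + k           ∎
    where open ≡-Reasoning

act-∈-colours : ∀ k {x} s → x ∈ colours k → act s x ∈ colours k
act-∈-colours k ⊕ x∈ = x∈
act-∈-colours k ⊖ x∈ = neg-∈-colours k x∈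

act-* : ∀ s t x → act (s * t) x ≡ act s (act t x)
act-* ⊕ t x = refl
act-* ⊖ ⊕ x = refl
act-* ⊖ ⊖ x = sym (neg-involutive x)

act-involutive : ∀ s x → act s (act s x) ≡ x
act-involutive s x = trans (sym (act-* s s x)) (cong (λ t → act t x) (s*s≡+ s))

act-injective : ∀ s {x y} → act s x ≡ act s y → x ≡ y
act-injective s {x} {y} eq = trans (sym (act-involutive s x)) (trans (cong (act s) eq) (act-involutive s y))

≠ᶻ-act : ∀ s x y → (act s x ≠ᶻ act s y) ≡ (x ≠ᶻ y)
≠ᶻ-act s x y = cong not (does-⇔ (mk⇔ (act-injective s) (cong (act s))) (act s x ℤ.≟ act s y) (x ℤ.≟ y))

act-switched : ∀ z s y x → act (z * (s * y)) (act z x) ≡ act y (act s x)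
act-switched z s y x = begin
  act (z * (s * y)) (act z x)  ≡⟨ act-* (z * (s * y)) z x ⟨
  act (z * (s * y) * z) x      ≡⟨ cong (λ t → act t x) conjugate ⟩
  act (y * s) x                ≡⟨ act-* y s x ⟩
  act y (act s x)              ∎
  where
  open ≡-Reasoning
  conjugate : z * (s * y) * z ≡ y * s
  conjugate = begin
    z * (s * y) * z  ≡⟨ solve 3 (λ z s y → (z · (s · y)) · z ⊜ (z · z) · (y · s)) refl z s y ⟩
    z * z * (y * s)  ≡⟨ cong (_* (y * s)) (s*s≡+ z) ⟩
    y * s            ∎

T-injective : ∀ {a b} → T a ⇔ T b → a ≡ b
T-injective eq = does-⇔ eq (T? _) (T? _)

T-or-false : ∀ b → T b ⊎ b ≡ false
T-or-false true  = inj₁ tt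
T-or-false false = inj₂ refl

T-and : ∀ {bs} → T (and bs) ⇔ All T bs
T-and = mk⇔ to from
  where
  to : ∀ {bs} → T (and bs) → All T bs
  to {[]}     _ = []
  to {b ∷ bs} t = let tb , tbs = Equivalence.to T-∧ t in tb ∷ to tbs
  from : ∀ {bs} → All T bs → T (and bs)
  from []         = tt
  from (tb ∷ tbs) = Equivalence.from T-∧ (tb , from tbs)

T-and-allPairs : ∀ {n} (g : Fin n → Fin n → Bool) →
  T (and (concatMap (λ u → map (g u) (allFin n)) (allFin n))) ⇔ (∀ u v → T (g u v))
T-and-allPairs g = mk⇔
  (λ t u v → tabulate⁻ (map⁻ (tabulate⁻ (map⁻ (concat⁻ (Equivalence.to T-and t))) u)) v)
  (λ h → Equivalence.from T-and (concat⁺ (map⁺ (tabulate⁺ λ u → map⁺ (tabulate⁺ (h u))))))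

T-isProper : ∀ σ κ → T (isProper σ κ) ⇔ (∀ u v → T (okAt σ κ u v))
T-isProper σ κ = T-and-allPairs (okAt σ κ)

∀-pairs : {P : V → V → Set} → All (λ u → All (P u) (allFin 10)) (allFin 10) → ∀ u v → P u v
∀-pairs table u v = tabulate⁻ {f = id} (tabulate⁻ {f = id} table u) v

ifᵀ_then_else_ : ∀ {a} {A : Set a} (b : Bool) → (T b → A) → A → A
ifᵀ true  then f else _ = f tt
ifᵀ false then _ else x = x

ifᵀ-true : ∀ {b} (t : T b) {f : T b → A} {x} → (ifᵀ b then f else x) ≡ f t
ifᵀ-true {b = true} _ = refl

ifᵀ-false : ∀ {b} → b ≡ false → {f : T b → A} {x : A} → (ifᵀ b then f else x) ≡ x
ifᵀ-false refl = refl

ifᵀ-elim : ∀ {b} {P : T b → Set} → (ifᵀ b then P else ⊤) → (t : T b) → P t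
ifᵀ-elim {true} p _ = p

-- okAt and sig are defined by with-abstraction over an equation, which cannot be abstracted
-- again; at concrete vertices they compute, so this unfolding is checked pair by pair.
okAt-unfold : ∀ σ κ u v →
  okAt σ κ u v ≡ (ifᵀ adj u v then (λ a → lookup κ v ≠ᶻ act (sig σ u v a) (lookup κ u)) else true)
okAt-unfold σ κ = ∀-pairs
  ( (refl ∷ refl ∷ refl ∷ refl ∷ refl ∷ refl ∷ refl ∷ refl ∷ refl ∷ refl ∷ [])
  ∷ (refl ∷ refl ∷ refl ∷ refl ∷ refl ∷ refl ∷ refl ∷ refl ∷ refl ∷ refl ∷ [])
  ∷ (refl ∷ refl ∷ refl ∷ refl ∷ refl ∷ refl ∷ refl ∷ refl ∷ refl ∷ refl ∷ [])
  ∷ (refl ∷ refl ∷ refl ∷ refl ∷ refl ∷ refl ∷ refl ∷ refl ∷ refl ∷ refl ∷ [])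
  ∷ (refl ∷ refl ∷ refl ∷ refl ∷ refl ∷ refl ∷ refl ∷ refl ∷ refl ∷ refl ∷ [])
  ∷ (refl ∷ refl ∷ refl ∷ refl ∷ refl ∷ refl ∷ refl ∷ refl ∷ refl ∷ refl ∷ [])
  ∷ (refl ∷ refl ∷ refl ∷ refl ∷ refl ∷ refl ∷ refl ∷ refl ∷ refl ∷ refl ∷ [])
  ∷ (refl ∷ refl ∷ refl ∷ refl ∷ refl ∷ refl ∷ refl ∷ refl ∷ refl ∷ refl ∷ [])
  ∷ (refl ∷ refl ∷ refl ∷ refl ∷ refl ∷ refl ∷ refl ∷ refl ∷ refl ∷ refl ∷ [])
  ∷ (refl ∷ refl ∷ refl ∷ refl ∷ refl ∷ refl ∷ refl ∷ refl ∷ refl ∷ refl ∷ [])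
  ∷ [])

Compatible : Signature → Signature → Automorphism → (V → Sign) → Set
Compatible σ τ φ ζ = ∀ u v (a : T (adj u v)) →
  sig τ (π u) (π v) (subst T (preserves u v) a) ≡ ζ u * (sig σ u v a * ζ v)
  where open Automorphism φ

module _ {σ τ : Signature} (iso : SwitchingIsomorphic σ τ) where
  open Automorphism (proj₁ iso)
  private
    ζ : V → Sign
    ζ = proj₁ (proj₂ iso)
    compatible : Compatible σ τ (proj₁ iso) ζ
    compatible = proj₂ (proj₂ iso)

  transport untransport : Vec ℤ 10 → Vec ℤ 10
  transport   κ = tabulate (λ x → act (ζ (π⁻¹ x)) (lookup κ (π⁻¹ x)))
  untransport κ = tabulate (λ u → act (ζ u) (lookup κ (π u)))

  lookup-transport : ∀ κ u → lookup (transport κ) (π u) ≡ act (ζ u) (lookup κ u)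
  lookup-transport κ u = trans (lookup∘tabulate (λ x → act (ζ (π⁻¹ x)) (lookup κ (π⁻¹ x))) (π u))
                               (cong (λ w → act (ζ w) (lookup κ w)) (inv₁ u))

  okAt-transport : ∀ κ u v → okAt τ (transport κ) (π u) (π v) ≡ okAt σ κ u v
  okAt-transport κ u v with T-or-false (adj u v)
  ... | inj₁ a = begin
    okAt τ (transport κ) (π u) (π v)
      ≡⟨ trans (okAt-unfold τ _ (π u) (π v)) (ifᵀ-true (subst T (preserves u v) a)) ⟩
    lookup (transport κ) (π v) ≠ᶻ act (sig τ (π u) (π v) (subst T (preserves u v) a)) (lookup (transport κ) (π u))
      ≡⟨ cong₂ (λ x s → x ≠ᶻ act s (lookup (transport κ) (π u))) (lookup-transport κ v) (compatible u v a) ⟩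
    act (ζ v) (lookup κ v) ≠ᶻ act (ζ u * (sig σ u v a * ζ v)) (lookup (transport κ) (π u))
      ≡⟨ cong (λ x → act (ζ v) (lookup κ v) ≠ᶻ act (ζ u * (sig σ u v a * ζ v)) x) (lookup-transport κ u) ⟩
    act (ζ v) (lookup κ v) ≠ᶻ act (ζ u * (sig σ u v a * ζ v)) (act (ζ u) (lookup κ u))
      ≡⟨ cong (act (ζ v) (lookup κ v) ≠ᶻ_) (act-switched (ζ u) (sig σ u v a) (ζ v) (lookup κ u)) ⟩
    act (ζ v) (lookup κ v) ≠ᶻ act (ζ v) (act (sig σ u v a) (lookup κ u))
      ≡⟨ ≠ᶻ-act (ζ v) _ _ ⟩
    lookup κ v ≠ᶻ act (sig σ u v a) (lookup κ u)
      ≡⟨ trans (okAt-unfold σ κ u v) (ifᵀ-true a) ⟨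
    okAt σ κ u v
      ∎
    where open ≡-Reasoning
  ... | inj₂ nonadjacent = trans (okAt-unfold τ _ (π u) (π v))
    (trans (ifᵀ-false (trans (sym (preserves u v)) nonadjacent))
    (sym (trans (okAt-unfold σ κ u v) (ifᵀ-false nonadjacent))))

  isProper-transport : ∀ κ → isProper τ (transport κ) ≡ isProper σ κ
  isProper-transport κ = T-injective (mk⇔ forward backward)
    where
    open Equivalence
    forward : T (isProper τ (transport κ)) → T (isProper σ κ)
    forward t = from (T-isProper σ κ) λ u v →
      subst T (okAt-transport κ u v) (to (T-isProper τ _) t (π u) (π v))
    backward : T (isProper σ κ) → T (isProper τ (transport κ))
    backward t = from (T-isProper τ _) λ x y →
      subst₂ (λ x y → T (okAt τ (transport κ) x y)) (inv₂ x) (inv₂ y)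
        (subst T (sym (okAt-transport κ (π⁻¹ x) (π⁻¹ y))) (to (T-isProper σ κ) t (π⁻¹ x) (π⁻¹ y)))

  transport-untransport : ∀ κ → transport (untransport κ) ≡ κ
  transport-untransport κ = trans (tabulate-cong entry) (tabulate∘lookup κ)
    where
    entry : ∀ x → act (ζ (π⁻¹ x)) (lookup (untransport κ) (π⁻¹ x)) ≡ lookup κ x
    entry x = begin
      act (ζ (π⁻¹ x)) (lookup (untransport κ) (π⁻¹ x))
        ≡⟨ cong (act (ζ (π⁻¹ x))) (lookup∘tabulate (λ u → act (ζ u) (lookup κ (π u))) (π⁻¹ x)) ⟩
      act (ζ (π⁻¹ x)) (act (ζ (π⁻¹ x)) (lookup κ (π (π⁻¹ x))))
        ≡⟨ act-involutive (ζ (π⁻¹ x)) _ ⟩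
      lookup κ (π (π⁻¹ x))
        ≡⟨ cong (lookup κ) (inv₂ x) ⟩
      lookup κ x
        ∎
      where open ≡-Reasoning

  untransport-transport : ∀ κ → untransport (transport κ) ≡ κ
  untransport-transport κ = trans (tabulate-cong entry) (tabulate∘lookup κ)
    where
    entry : ∀ u → act (ζ u) (lookup (transport κ) (π u)) ≡ lookup κ u
    entry u = trans (cong (act (ζ u)) (lookup-transport κ u)) (act-involutive (ζ u) (lookup κ u))

  module _ (k : ℕ) where
    over-tabulate : ∀ {f : Fin 10 → ℤ} → (∀ i → f i ∈ colours k) → Over (colours k) (tabulate f)
    over-tabulate {f} f∈ = lookup⁻ λ i → subst (_∈ colours k) (sym (lookup∘tabulate f i)) (f∈ i)

    transport-over : ∀ {κ} → Over (colours k) κ → Over (colours k) (transport κ)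
    transport-over over = over-tabulate λ x → act-∈-colours k (ζ (π⁻¹ x)) (lookup⁺ over (π⁻¹ x))

    untransport-over : ∀ {κ} → Over (colours k) κ → Over (colours k) (untransport κ)
    untransport-over over = over-tabulate λ u → act-∈-colours k (ζ u) (lookup⁺ over (π u))

  numColorations-invariant : ∀ k → numColorations σ k ≡ numColorations τ k
  numColorations-invariant k = sym (trans
    (count-allVecs-∘ (colours-unique k) transport untransport (transport-over k) (untransport-over k)
       transport-untransport untransport-transport (isProper τ))
    (count-cong isProper-transport (allVecs 10 (colours k))))

sig-irrelevant : ∀ σ u v (a a′ : T (adj u v)) → sig σ u v a ≡ sig σ u v a′
sig-irrelevant σ u v a a′ = cong (sig σ u v) (T-irrelevant a a′)

sig-cong : ∀ σ {u u′ v v′} → u ≡ u′ → v ≡ v′ → (a : T (adj u v)) (a′ : T (adj u′ v′)) →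
  sig σ u v a ≡ sig σ u′ v′ a′
sig-cong σ {u} {_} {v} refl refl = sig-irrelevant σ u v

unswitch : ∀ z s y → s ≡ z * ((z * (s * y)) * y)
unswitch z s y = begin
  s                        ≡⟨ trans (cong₂ (λ p q → p * (s * q)) (s*s≡+ z) (s*s≡+ y)) (*-identityʳ s) ⟨
  (z * z) * (s * (y * y))  ≡⟨ solve 3 (λ z s y → (z · z) · (s · (y · y)) ⊜ z · ((z · (s · y)) · y)) refl z s y ⟩
  z * ((z * (s * y)) * y)  ∎
  where open ≡-Reasoning

switchingIsomorphic-sym : ∀ {σ τ} → SwitchingIsomorphic σ τ → SwitchingIsomorphic τ σ
switchingIsomorphic-sym {σ} {τ} (φ , ζ , compatible) = φ⁻¹ , ζ ∘ π⁻¹ , compatible⁻¹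
  where
  open Automorphism φ
  preserves⁻¹ : ∀ x y → adj x y ≡ adj (π⁻¹ x) (π⁻¹ y)
  preserves⁻¹ x y = sym (trans (preserves (π⁻¹ x) (π⁻¹ y)) (cong₂ adj (inv₂ x) (inv₂ y)))
  φ⁻¹ : Automorphism
  φ⁻¹ = record { π = π⁻¹ ; π⁻¹ = π ; inv₁ = inv₂ ; inv₂ = inv₁ ; preserves = preserves⁻¹ }
  compatible⁻¹ : Compatible τ σ φ⁻¹ (ζ ∘ π⁻¹)
  compatible⁻¹ x y a = trans (unswitch (ζ u) (sig σ u v b) (ζ v))
    (cong (λ t → ζ u * (t * ζ v))
      (sym (trans (sig-cong τ (sym (inv₂ x)) (sym (inv₂ y)) a (subst T (preserves u v) b)) (compatible u v b))))
    where
    u v : V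
    u = π⁻¹ x
    v = π⁻¹ y
    b : T (adj u v)
    b = subst T (preserves⁻¹ x y) a

switchingIsomorphic-trans : ∀ {σ τ ρ} → SwitchingIsomorphic σ τ → SwitchingIsomorphic τ ρ → SwitchingIsomorphic σ ρ
switchingIsomorphic-trans {σ} {τ} {ρ} (φ₁ , ζ₁ , compatible₁) (φ₂ , ζ₂ , compatible₂) = φ , ζ , compatible
  where
  module A = Automorphism φ₁
  module B = Automorphism φ₂
  preserves : ∀ u v → adj u v ≡ adj (B.π (A.π u)) (B.π (A.π v))
  preserves u v = trans (A.preserves u v) (B.preserves (A.π u) (A.π v))
  φ : Automorphism
  φ = record
    { π = B.π ∘ A.π ; π⁻¹ = A.π⁻¹ ∘ B.π⁻¹
    ; inv₁ = λ v → trans (cong A.π⁻¹ (B.inv₁ (A.π v))) (A.inv₁ v)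
    ; inv₂ = λ v → trans (cong B.π (A.inv₂ (B.π⁻¹ v))) (B.inv₂ v)
    ; preserves = preserves }
  ζ : V → Sign
  ζ u = ζ₁ u * ζ₂ (A.π u)
  compatible : Compatible σ ρ φ ζ
  compatible u v a = begin
    sig ρ (B.π (A.π u)) (B.π (A.π v)) (subst T (preserves u v) a)
      ≡⟨ sig-irrelevant ρ (B.π (A.π u)) (B.π (A.π v)) _ (subst T (B.preserves (A.π u) (A.π v)) b) ⟩
    sig ρ (B.π (A.π u)) (B.π (A.π v)) (subst T (B.preserves (A.π u) (A.π v)) b)
      ≡⟨ compatible₂ (A.π u) (A.π v) b ⟩
    ζ₂ (A.π u) * (sig τ (A.π u) (A.π v) b * ζ₂ (A.π v))
      ≡⟨ cong (λ t → ζ₂ (A.π u) * (t * ζ₂ (A.π v))) (compatible₁ u v a) ⟩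
    ζ₂ (A.π u) * ((ζ₁ u * (sig σ u v a * ζ₁ v)) * ζ₂ (A.π v))
      ≡⟨ solve 5 (λ a b s c d → b · ((a · (s · c)) · d) ⊜ (a · b) · (s · (c · d))) refl
           (ζ₁ u) (ζ₂ (A.π u)) (sig σ u v a) (ζ₁ v) (ζ₂ (A.π v)) ⟩
    ζ u * (sig σ u v a * ζ v)
      ∎
    where
    open ≡-Reasoning
    b : T (adj (A.π u) (A.π v))
    b = subst T (A.preserves u v) a

firstVertex : (V → Bool) → V
firstVertex p = foldr (λ w w′ → if p w then w else w′) 0F (allFin 10)

inverse : (V → V) → V → V
inverse π y = firstVertex (λ x → does (π x Fin.≟ y))

IsAutomorphism : (V → V) → Set
IsAutomorphism π =
  (∀ v → inverse π (π v) ≡ v) × (∀ v → π (inverse π v) ≡ v) × (∀ u v → adj u v ≡ adj (π u) (π v))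

isAutomorphism? : ∀ π → Dec (IsAutomorphism π)
isAutomorphism? π = all? (λ v → inverse π (π v) Fin.≟ v)
              ×-dec all? (λ v → π (inverse π v) Fin.≟ v)
              ×-dec all? (λ u → all? λ v → adj u v Bool.≟ adj (π u) (π v))

automorphism : ∀ π → IsAutomorphism π → Automorphism
automorphism π (inv₁ , inv₂ , preserves) =
  record { π = π ; π⁻¹ = inverse π ; inv₁ = inv₁ ; inv₂ = inv₂ ; preserves = preserves }

∀ᵀ? : ∀ {b} {P : T b → Set} → ((t : T b) → Dec (P t)) → Dec ((t : T b) → P t)
∀ᵀ? {false} P? = yes λ ()
∀ᵀ? {true}  P? = map′ (λ p _ → p) (λ f → f tt) (P? tt)

compatible? : ∀ σ τ φ ζ → Dec (Compatible σ τ φ ζ)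
compatible? σ τ φ ζ = all? λ u → all? λ v → ∀ᵀ? λ a → _ Sign.≟ _

-- the vertex labelled {i, j}, in either order (junk on the diagonal)
vertex : Fin 5 → Fin 5 → V
vertex 0F 1F = 0F
vertex 0F 2F = 1F
vertex 0F 3F = 2F
vertex 0F 4F = 3F
vertex 1F 2F = 4F
vertex 1F 3F = 5F
vertex 1F 4F = 6F
vertex 2F 3F = 7F
vertex 2F 4F = 8F
vertex 3F 4F = 9F
vertex 1F 0F = 0F
vertex 2F 0F = 1F
vertex 3F 0F = 2F
vertex 4F 0F = 3F
vertex 2F 1F = 4F
vertex 3F 1F = 5F
vertex 4F 1F = 6F
vertex 3F 2F = 7F
vertex 4F 2F = 8F
vertex 4F 3F = 9F
vertex _  _  = 0F

induced : (Fin 5 → Fin 5) → V → V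
induced p v = vertex (p (proj₁ (label v))) (p (proj₂ (label v)))

switchingAt : List V → V → Sign
switchingAt vs v = if any (λ w → does (w Fin.≟ v)) vs then ⊖ else ⊕

switchingIsomorphism : ∀ {σ τ} (p : Vec (Fin 5) 5) (vs : List V)
  {aut : True (isAutomorphism? (induced (lookup p)))}
  {compat : True (compatible? σ τ (automorphism (induced (lookup p)) (toWitness aut)) (switchingAt vs))} →
  SwitchingIsomorphic σ τ
switchingIsomorphism p vs {aut} {compat} =
  automorphism (induced (lookup p)) (toWitness aut) , switchingAt vs , toWitness compat

-- Switching along the spanning tree of P rooted at 12 with edges 12-34, 12-35, 12-45, 34-15,
-- 34-25, 35-14, 35-24, 45-13, 45-23 makes every tree edge positive; the cotree edges are
-- 13-24, 13-25, 14-23, 14-25, 15-23, 15-24.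
treeSwitching : Signature → V → Sign
treeSwitching σ 0F = ⊕
treeSwitching σ 7F = sig σ 0F 7F tt
treeSwitching σ 8F = sig σ 0F 8F tt
treeSwitching σ 9F = sig σ 0F 9F tt
treeSwitching σ 3F = sig σ 0F 7F tt * sig σ 7F 3F tt
treeSwitching σ 6F = sig σ 0F 7F tt * sig σ 7F 6F tt
treeSwitching σ 2F = sig σ 0F 8F tt * sig σ 8F 2F tt
treeSwitching σ 5F = sig σ 0F 8F tt * sig σ 8F 5F tt
treeSwitching σ 1F = sig σ 0F 9F tt * sig σ 9F 1F tt
treeSwitching σ 4F = sig σ 0F 9F tt * sig σ 9F 4F tt

normalForm : (b₀ b₁ b₂ b₃ b₄ b₅ : Sign) → Signature
normalForm b₀ b₁ b₂ b₃ b₄ b₅ ((u , v) , _) = cotree u v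
  where
  cotree : V → V → Sign
  cotree 1F 5F = b₀
  cotree 1F 6F = b₁
  cotree 2F 4F = b₂
  cotree 2F 6F = b₃
  cotree 3F 4F = b₄
  cotree 3F 5F = b₅
  cotree _  _  = ⊕

switchedSign : Signature → (u v : V) → T (adj u v) → Sign
switchedSign σ u v a = treeSwitching σ u * (sig σ u v a * treeSwitching σ v)

normalFormOf : Signature → Signature
normalFormOf σ = normalForm
  (switchedSign σ 1F 5F tt) (switchedSign σ 1F 6F tt) (switchedSign σ 2F 4F tt)
  (switchedSign σ 2F 6F tt) (switchedSign σ 3F 4F tt) (switchedSign σ 3F 5F tt)

identityAutomorphism : Automorphism
identityAutomorphism = record
  { π = id ; π⁻¹ = id ; inv₁ = λ _ → refl ; inv₂ = λ _ → refl ; preserves = λ _ _ → refl }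

tree-edge : ∀ z s → ⊕ ≡ z * (s * (z * s))
tree-edge z s = begin
  ⊕                  ≡⟨ cong₂ _*_ (s*s≡+ z) (s*s≡+ s) ⟨
  (z * z) * (s * s)  ≡⟨ solve 2 (λ z s → (z · z) · (s · s) ⊜ z · (s · (z · s))) refl z s ⟩
  z * (s * (z * s))  ∎
  where open ≡-Reasoning

tree-edge′ : ∀ z s → ⊕ ≡ (z * s) * (s * z)
tree-edge′ z s = trans (tree-edge z s) (solve 2 (λ z s → z · (s · (z · s)) ⊜ (z · s) · (s · z)) refl z s)

swap-ends : ∀ z s y → z * (s * y) ≡ y * (s * z)
swap-ends = solve 3 (λ z s y → z · (s · y) ⊜ y · (s · z)) refl

switchingIsomorphic-normalForm : ∀ σ → SwitchingIsomorphic σ (normalFormOf σ)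
switchingIsomorphic-normalForm σ = identityAutomorphism , ζ , λ u v → ifᵀ-elim (compatible u v)
  where
  ζ : V → Sign
  ζ = treeSwitching σ
  down : ∀ p c (a : T (adj p c)) → ⊕ ≡ ζ p * (sig σ p c a * (ζ p * sig σ p c a))
  down p c a = tree-edge (ζ p) (sig σ p c a)
  up : ∀ p c (a : T (adj p c)) → ⊕ ≡ (ζ p * sig σ p c a) * (sig σ p c a * ζ p)
  up p c a = tree-edge′ (ζ p) (sig σ p c a)
  reversed : ∀ u v (a : T (adj u v)) → ζ u * (sig σ u v a * ζ v) ≡ ζ v * (sig σ u v a * ζ u)
  reversed u v a = swap-ends (ζ u) (sig σ u v a) (ζ v)
  compatible : ∀ u v → ifᵀ adj u v then (λ a → sig (normalFormOf σ) u v a ≡ ζ u * (sig σ u v a * ζ v)) else ⊤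
  compatible = ∀-pairs
    ( (_ ∷ _ ∷ _ ∷ _ ∷ _ ∷ _ ∷ _ ∷ down 0F 7F _ ∷ down 0F 8F _ ∷ down 0F 9F _ ∷ [])
    ∷ (_ ∷ _ ∷ _ ∷ _ ∷ _ ∷ refl ∷ refl ∷ _ ∷ _ ∷ up 9F 1F _ ∷ [])
    ∷ (_ ∷ _ ∷ _ ∷ _ ∷ refl ∷ _ ∷ refl ∷ _ ∷ up 8F 2F _ ∷ _ ∷ [])
    ∷ (_ ∷ _ ∷ _ ∷ _ ∷ refl ∷ refl ∷ _ ∷ up 7F 3F _ ∷ _ ∷ _ ∷ [])
    ∷ (_ ∷ _ ∷ reversed 2F 4F _ ∷ reversed 3F 4F _ ∷ _ ∷ _ ∷ _ ∷ _ ∷ _ ∷ up 9F 4F _ ∷ [])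
    ∷ (_ ∷ reversed 1F 5F _ ∷ _ ∷ reversed 3F 5F _ ∷ _ ∷ _ ∷ _ ∷ _ ∷ up 8F 5F _ ∷ _ ∷ [])
    ∷ (_ ∷ reversed 1F 6F _ ∷ reversed 2F 6F _ ∷ _ ∷ _ ∷ _ ∷ _ ∷ up 7F 6F _ ∷ _ ∷ _ ∷ [])
    ∷ (up 0F 7F _ ∷ _ ∷ _ ∷ down 7F 3F _ ∷ _ ∷ _ ∷ down 7F 6F _ ∷ _ ∷ _ ∷ _ ∷ [])
    ∷ (up 0F 8F _ ∷ _ ∷ down 8F 2F _ ∷ _ ∷ _ ∷ down 8F 5F _ ∷ _ ∷ _ ∷ _ ∷ _ ∷ [])
    ∷ (up 0F 9F _ ∷ down 9F 1F _ ∷ _ ∷ _ ∷ down 9F 4F _ ∷ _ ∷ _ ∷ _ ∷ _ ∷ _ ∷ [])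
    ∷ [])

representative : Fin 6 → Signature
representative 0F = normalForm ⊕ ⊕ ⊕ ⊕ ⊕ ⊕
representative 1F = normalForm ⊕ ⊕ ⊕ ⊕ ⊕ ⊖
representative 2F = normalForm ⊕ ⊕ ⊕ ⊖ ⊕ ⊖
representative 3F = normalForm ⊕ ⊕ ⊕ ⊖ ⊖ ⊕
representative 4F = normalForm ⊕ ⊖ ⊖ ⊕ ⊕ ⊖
representative 5F = normalForm ⊖ ⊖ ⊖ ⊖ ⊖ ⊖

-- Each witness is an automorphism of P, given by a permutation of {1,…,5}, together with the
-- vertices to switch; both are verified by evaluation.
classify : ∀ b₀ b₁ b₂ b₃ b₄ b₅ →
  Σ (Fin 6) λ c → SwitchingIsomorphic (normalForm b₀ b₁ b₂ b₃ b₄ b₅) (representative c)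
classify ⊕ ⊕ ⊕ ⊕ ⊕ ⊕ = 0F , switchingIsomorphism (0F ∷ 1F ∷ 2F ∷ 3F ∷ 4F ∷ []) []
classify ⊕ ⊕ ⊕ ⊕ ⊕ ⊖ = 1F , switchingIsomorphism (0F ∷ 1F ∷ 2F ∷ 3F ∷ 4F ∷ []) []
classify ⊕ ⊕ ⊕ ⊕ ⊖ ⊕ = 1F , switchingIsomorphism (0F ∷ 1F ∷ 3F ∷ 2F ∷ 4F ∷ []) []
classify ⊕ ⊕ ⊕ ⊕ ⊖ ⊖ = 1F , switchingIsomorphism (0F ∷ 2F ∷ 1F ∷ 3F ∷ 4F ∷ []) (3F ∷ [])
classify ⊕ ⊕ ⊕ ⊖ ⊕ ⊕ = 1F , switchingIsomorphism (0F ∷ 1F ∷ 2F ∷ 4F ∷ 3F ∷ []) []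
classify ⊕ ⊕ ⊕ ⊖ ⊕ ⊖ = 2F , switchingIsomorphism (0F ∷ 1F ∷ 2F ∷ 3F ∷ 4F ∷ []) []
classify ⊕ ⊕ ⊕ ⊖ ⊖ ⊕ = 3F , switchingIsomorphism (0F ∷ 1F ∷ 2F ∷ 3F ∷ 4F ∷ []) []
classify ⊕ ⊕ ⊕ ⊖ ⊖ ⊖ = 3F , switchingIsomorphism (4F ∷ 0F ∷ 1F ∷ 2F ∷ 3F ∷ []) (3F ∷ 6F ∷ 7F ∷ [])
classify ⊕ ⊕ ⊖ ⊕ ⊕ ⊕ = 1F , switchingIsomorphism (0F ∷ 1F ∷ 3F ∷ 4F ∷ 2F ∷ []) []
classify ⊕ ⊕ ⊖ ⊕ ⊕ ⊖ = 3F , switchingIsomorphism (0F ∷ 1F ∷ 2F ∷ 4F ∷ 3F ∷ []) []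
classify ⊕ ⊕ ⊖ ⊕ ⊖ ⊕ = 1F , switchingIsomorphism (2F ∷ 0F ∷ 4F ∷ 1F ∷ 3F ∷ []) (4F ∷ [])
classify ⊕ ⊕ ⊖ ⊕ ⊖ ⊖ = 3F , switchingIsomorphism (0F ∷ 2F ∷ 1F ∷ 4F ∷ 3F ∷ []) (3F ∷ [])
classify ⊕ ⊕ ⊖ ⊖ ⊕ ⊕ = 1F , switchingIsomorphism (0F ∷ 2F ∷ 1F ∷ 4F ∷ 3F ∷ []) (2F ∷ [])
classify ⊕ ⊕ ⊖ ⊖ ⊕ ⊖ = 3F , switchingIsomorphism (4F ∷ 0F ∷ 1F ∷ 3F ∷ 2F ∷ []) (2F ∷ 5F ∷ 8F ∷ [])
classify ⊕ ⊕ ⊖ ⊖ ⊖ ⊕ = 3F , switchingIsomorphism (0F ∷ 2F ∷ 1F ∷ 3F ∷ 4F ∷ []) (2F ∷ [])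
classify ⊕ ⊕ ⊖ ⊖ ⊖ ⊖ = 2F , switchingIsomorphism (0F ∷ 2F ∷ 1F ∷ 3F ∷ 4F ∷ []) (2F ∷ 3F ∷ [])
classify ⊕ ⊖ ⊕ ⊕ ⊕ ⊕ = 1F , switchingIsomorphism (0F ∷ 1F ∷ 4F ∷ 2F ∷ 3F ∷ []) []
classify ⊕ ⊖ ⊕ ⊕ ⊕ ⊖ = 3F , switchingIsomorphism (0F ∷ 1F ∷ 3F ∷ 2F ∷ 4F ∷ []) []
classify ⊕ ⊖ ⊕ ⊕ ⊖ ⊕ = 2F , switchingIsomorphism (0F ∷ 1F ∷ 3F ∷ 2F ∷ 4F ∷ []) []
classify ⊕ ⊖ ⊕ ⊕ ⊖ ⊖ = 3F , switchingIsomorphism (4F ∷ 0F ∷ 2F ∷ 1F ∷ 3F ∷ []) (3F ∷ 6F ∷ 7F ∷ [])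
classify ⊕ ⊖ ⊕ ⊖ ⊕ ⊕ = 1F , switchingIsomorphism (2F ∷ 0F ∷ 1F ∷ 3F ∷ 4F ∷ []) (6F ∷ [])
classify ⊕ ⊖ ⊕ ⊖ ⊕ ⊖ = 3F , switchingIsomorphism (0F ∷ 4F ∷ 1F ∷ 2F ∷ 3F ∷ []) (3F ∷ 6F ∷ 7F ∷ [])
classify ⊕ ⊖ ⊕ ⊖ ⊖ ⊕ = 3F , switchingIsomorphism (0F ∷ 4F ∷ 2F ∷ 1F ∷ 3F ∷ []) (3F ∷ 6F ∷ 7F ∷ [])
classify ⊕ ⊖ ⊕ ⊖ ⊖ ⊖ = 1F , switchingIsomorphism (0F ∷ 4F ∷ 1F ∷ 3F ∷ 2F ∷ []) (3F ∷ 6F ∷ 7F ∷ [])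
classify ⊕ ⊖ ⊖ ⊕ ⊕ ⊕ = 3F , switchingIsomorphism (0F ∷ 1F ∷ 4F ∷ 3F ∷ 2F ∷ []) []
classify ⊕ ⊖ ⊖ ⊕ ⊕ ⊖ = 4F , switchingIsomorphism (0F ∷ 1F ∷ 2F ∷ 3F ∷ 4F ∷ []) []
classify ⊕ ⊖ ⊖ ⊕ ⊖ ⊕ = 3F , switchingIsomorphism (0F ∷ 4F ∷ 3F ∷ 1F ∷ 2F ∷ []) (1F ∷ 4F ∷ 9F ∷ [])
classify ⊕ ⊖ ⊖ ⊕ ⊖ ⊖ = 3F , switchingIsomorphism (0F ∷ 3F ∷ 1F ∷ 4F ∷ 2F ∷ []) (2F ∷ 3F ∷ 6F ∷ 7F ∷ [])
classify ⊕ ⊖ ⊖ ⊖ ⊕ ⊕ = 3F , switchingIsomorphism (0F ∷ 2F ∷ 4F ∷ 3F ∷ 1F ∷ []) (2F ∷ [])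
classify ⊕ ⊖ ⊖ ⊖ ⊕ ⊖ = 3F , switchingIsomorphism (0F ∷ 3F ∷ 4F ∷ 2F ∷ 1F ∷ []) (1F ∷ 2F ∷ 5F ∷ 8F ∷ [])
classify ⊕ ⊖ ⊖ ⊖ ⊖ ⊕ = 2F , switchingIsomorphism (2F ∷ 0F ∷ 3F ∷ 1F ∷ 4F ∷ []) (4F ∷ 6F ∷ [])
classify ⊕ ⊖ ⊖ ⊖ ⊖ ⊖ = 2F , switchingIsomorphism (0F ∷ 3F ∷ 1F ∷ 4F ∷ 2F ∷ []) (3F ∷ 6F ∷ 7F ∷ [])
classify ⊖ ⊕ ⊕ ⊕ ⊕ ⊕ = 1F , switchingIsomorphism (0F ∷ 1F ∷ 4F ∷ 3F ∷ 2F ∷ []) []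
classify ⊖ ⊕ ⊕ ⊕ ⊕ ⊖ = 1F , switchingIsomorphism (2F ∷ 0F ∷ 1F ∷ 4F ∷ 3F ∷ []) (5F ∷ [])
classify ⊖ ⊕ ⊕ ⊕ ⊖ ⊕ = 3F , switchingIsomorphism (0F ∷ 1F ∷ 4F ∷ 2F ∷ 3F ∷ []) []
classify ⊖ ⊕ ⊕ ⊕ ⊖ ⊖ = 3F , switchingIsomorphism (0F ∷ 2F ∷ 4F ∷ 1F ∷ 3F ∷ []) (3F ∷ [])
classify ⊖ ⊕ ⊕ ⊖ ⊕ ⊕ = 3F , switchingIsomorphism (0F ∷ 1F ∷ 3F ∷ 4F ∷ 2F ∷ []) []
classify ⊖ ⊕ ⊕ ⊖ ⊕ ⊖ = 3F , switchingIsomorphism (0F ∷ 4F ∷ 1F ∷ 3F ∷ 2F ∷ []) (2F ∷ 5F ∷ 8F ∷ [])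
classify ⊖ ⊕ ⊕ ⊖ ⊖ ⊕ = 4F , switchingIsomorphism (0F ∷ 1F ∷ 2F ∷ 4F ∷ 3F ∷ []) []
classify ⊖ ⊕ ⊕ ⊖ ⊖ ⊖ = 3F , switchingIsomorphism (0F ∷ 3F ∷ 4F ∷ 1F ∷ 2F ∷ []) (1F ∷ 3F ∷ 6F ∷ 7F ∷ [])
classify ⊖ ⊕ ⊖ ⊕ ⊕ ⊕ = 2F , switchingIsomorphism (0F ∷ 1F ∷ 3F ∷ 4F ∷ 2F ∷ []) []
classify ⊖ ⊕ ⊖ ⊕ ⊕ ⊖ = 3F , switchingIsomorphism (0F ∷ 4F ∷ 2F ∷ 3F ∷ 1F ∷ []) (2F ∷ 5F ∷ 8F ∷ [])
classify ⊖ ⊕ ⊖ ⊕ ⊖ ⊕ = 3F , switchingIsomorphism (0F ∷ 4F ∷ 3F ∷ 2F ∷ 1F ∷ []) (1F ∷ 4F ∷ 9F ∷ [])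
classify ⊖ ⊕ ⊖ ⊕ ⊖ ⊖ = 2F , switchingIsomorphism (2F ∷ 0F ∷ 3F ∷ 4F ∷ 1F ∷ []) (4F ∷ 5F ∷ [])
classify ⊖ ⊕ ⊖ ⊖ ⊕ ⊕ = 3F , switchingIsomorphism (4F ∷ 0F ∷ 2F ∷ 3F ∷ 1F ∷ []) (2F ∷ 5F ∷ 8F ∷ [])
classify ⊖ ⊕ ⊖ ⊖ ⊕ ⊖ = 1F , switchingIsomorphism (0F ∷ 4F ∷ 1F ∷ 2F ∷ 3F ∷ []) (2F ∷ 5F ∷ 8F ∷ [])
classify ⊖ ⊕ ⊖ ⊖ ⊖ ⊕ = 3F , switchingIsomorphism (0F ∷ 3F ∷ 1F ∷ 2F ∷ 4F ∷ []) (2F ∷ 3F ∷ 5F ∷ 8F ∷ [])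
classify ⊖ ⊕ ⊖ ⊖ ⊖ ⊖ = 2F , switchingIsomorphism (0F ∷ 3F ∷ 1F ∷ 2F ∷ 4F ∷ []) (2F ∷ 5F ∷ 8F ∷ [])
classify ⊖ ⊖ ⊕ ⊕ ⊕ ⊕ = 1F , switchingIsomorphism (0F ∷ 2F ∷ 4F ∷ 1F ∷ 3F ∷ []) (1F ∷ [])
classify ⊖ ⊖ ⊕ ⊕ ⊕ ⊖ = 3F , switchingIsomorphism (0F ∷ 2F ∷ 3F ∷ 1F ∷ 4F ∷ []) (1F ∷ [])
classify ⊖ ⊖ ⊕ ⊕ ⊖ ⊕ = 3F , switchingIsomorphism (4F ∷ 0F ∷ 3F ∷ 1F ∷ 2F ∷ []) (1F ∷ 4F ∷ 9F ∷ [])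
classify ⊖ ⊖ ⊕ ⊕ ⊖ ⊖ = 2F , switchingIsomorphism (0F ∷ 2F ∷ 3F ∷ 1F ∷ 4F ∷ []) (1F ∷ 3F ∷ [])
classify ⊖ ⊖ ⊕ ⊖ ⊕ ⊕ = 3F , switchingIsomorphism (0F ∷ 2F ∷ 3F ∷ 4F ∷ 1F ∷ []) (1F ∷ [])
classify ⊖ ⊖ ⊕ ⊖ ⊕ ⊖ = 2F , switchingIsomorphism (2F ∷ 0F ∷ 1F ∷ 3F ∷ 4F ∷ []) (5F ∷ 6F ∷ [])
classify ⊖ ⊖ ⊕ ⊖ ⊖ ⊕ = 3F , switchingIsomorphism (0F ∷ 3F ∷ 2F ∷ 4F ∷ 1F ∷ []) (1F ∷ 2F ∷ 4F ∷ 9F ∷ [])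
classify ⊖ ⊖ ⊕ ⊖ ⊖ ⊖ = 2F , switchingIsomorphism (0F ∷ 3F ∷ 4F ∷ 1F ∷ 2F ∷ []) (3F ∷ 6F ∷ 7F ∷ [])
classify ⊖ ⊖ ⊖ ⊕ ⊕ ⊕ = 3F , switchingIsomorphism (4F ∷ 0F ∷ 3F ∷ 2F ∷ 1F ∷ []) (1F ∷ 4F ∷ 9F ∷ [])
classify ⊖ ⊖ ⊖ ⊕ ⊕ ⊖ = 3F , switchingIsomorphism (0F ∷ 3F ∷ 2F ∷ 1F ∷ 4F ∷ []) (1F ∷ 3F ∷ 4F ∷ 9F ∷ [])
classify ⊖ ⊖ ⊖ ⊕ ⊖ ⊕ = 1F , switchingIsomorphism (0F ∷ 4F ∷ 2F ∷ 1F ∷ 3F ∷ []) (1F ∷ 4F ∷ 9F ∷ [])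
classify ⊖ ⊖ ⊖ ⊕ ⊖ ⊖ = 2F , switchingIsomorphism (0F ∷ 3F ∷ 2F ∷ 1F ∷ 4F ∷ []) (1F ∷ 4F ∷ 9F ∷ [])
classify ⊖ ⊖ ⊖ ⊖ ⊕ ⊕ = 2F , switchingIsomorphism (0F ∷ 2F ∷ 3F ∷ 4F ∷ 1F ∷ []) (1F ∷ 2F ∷ [])
classify ⊖ ⊖ ⊖ ⊖ ⊕ ⊖ = 2F , switchingIsomorphism (0F ∷ 3F ∷ 4F ∷ 2F ∷ 1F ∷ []) (2F ∷ 5F ∷ 8F ∷ [])
classify ⊖ ⊖ ⊖ ⊖ ⊖ ⊕ = 2F , switchingIsomorphism (0F ∷ 3F ∷ 2F ∷ 4F ∷ 1F ∷ []) (1F ∷ 4F ∷ 9F ∷ [])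
classify ⊖ ⊖ ⊖ ⊖ ⊖ ⊖ = 5F , switchingIsomorphism (0F ∷ 1F ∷ 2F ∷ 3F ∷ 4F ∷ []) []

classification : ∀ σ → Σ (Fin 6) λ c → SwitchingIsomorphic σ (representative c)
classification σ = map₂ (switchingIsomorphic-trans (switchingIsomorphic-normalForm σ))
  (classify (switchedSign σ 1F 5F tt) (switchedSign σ 1F 6F tt) (switchedSign σ 2F 4F tt)
            (switchedSign σ 2F 6F tt) (switchedSign σ 3F 4F tt) (switchedSign σ 3F 5F tt))

classOf : Signature → Fin 6
classOf σ = proj₁ (classification σ)

switchingIsomorphic-representative : ∀ σ → SwitchingIsomorphic σ (representative (classOf σ))
switchingIsomorphic-representative σ = proj₂ (classification σ)

classCount : Fin 6 → ℕ
classCount 0F = 120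
classCount 1F = 112
classCount 2F = 136
classCount 3F = 108
classCount 4F = 80
classCount 5F = 202

numColorations-representative : ∀ c → numColorations (representative c) 1 ≡ classCount c
numColorations-representative 0F = refl
numColorations-representative 1F = refl
numColorations-representative 2F = refl
numColorations-representative 3F = refl
numColorations-representative 4F = refl
numColorations-representative 5F = refl

classCount-injective : ∀ c d → classCount c ≡ classCount d → c ≡ d
classCount-injective = toWitness {a? = all? λ c → all? λ d → (classCount c ℕ.≟ classCount d) →-dec (c Fin.≟ d)} tt

numColorations-classCount : ∀ σ → numColorations σ 1 ≡ classCount (classOf σ)
numColorations-classCount σ =
  trans (numColorations-invariant (switchingIsomorphic-representative σ) 1) (numColorations-representative (classOf σ))

numColorations≡⇒switchingIsomorphic : ∀ {σ τ} → numColorations σ 1 ≡ numColorations τ 1 → SwitchingIsomorphic σ τ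
numColorations≡⇒switchingIsomorphic {σ} {τ} eq = switchingIsomorphic-trans (switchingIsomorphic-representative σ)
  (subst (λ c → SwitchingIsomorphic (representative c) τ) (sym sameClass)
         (switchingIsomorphic-sym (switchingIsomorphic-representative τ)))
  where
  sameClass : classOf σ ≡ classOf τ
  sameClass = classCount-injective (classOf σ) (classOf τ)
    (trans (sym (numColorations-classCount σ)) (trans eq (numColorations-classCount τ)))

theorem9p4 : (σ τ : Signature) → ¬ SwitchingIsomorphic σ τ →
    ((p q : List ℤ) → IsChromaticPolynomial σ p → IsChromaticPolynomial τ q →
       Σ ℤ (λ x → eval p x ≢ eval q x))
    × (numColorations σ 1 ≢ numColorations τ 1)
theorem9p4 σ τ σ≇τ = differentPolynomials , differentCounts
  where
  differentCounts : numColorations σ 1 ≢ numColorations τ 1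
  differentCounts = σ≇τ ∘ numColorations≡⇒switchingIsomorphic
  differentPolynomials : (p q : List ℤ) → IsChromaticPolynomial σ p → IsChromaticPolynomial τ q →
    Σ ℤ (λ x → eval p x ≢ eval q x)
  differentPolynomials p q χσ χτ = + 3 , λ eq → differentCounts (+-injective (trans (sym (χσ 1)) (trans eq (χτ 1))))
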